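{- Let $q$ be an indeterminate (or a nonzero complex number that is not a root of unity), let $a,b,x$ be parameters and $n\ge0$. For $m\ge0$ put $c_m=q^mb+[m]a$. Then $$\sum_{k=0}^n\begin{bmatrix}n\\k\end{bmatrix}(-1)^k\,\bigl(c_{n-k}\dagger x\bigr)^{n-k}\,\bigl(x\dagger qc_{n-k}\bigr)^k=[n]!\,a^n.$$
   Context: $[n]=\frac{1-q^n}{1-q}$, $[n]!=\prod_{j=1}^n[j]$, $\begin{bmatrix}n\\k\end{bmatrix}=\frac{[n]!}{[k]![n-k]!}$. For quantities $y,x$ and $m\ge0$, $(y\dagger x)^m:=\prod_{j=0}^{m-1}(y+q^jx)$ (empty product $=1$). -}

module Defs where

open import Level using (Level)
open import Data.Nat using (ℕ; zero; suc; _∸_)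
open import Algebra.Bundles using (CommutativeRing)

-- All q-notions are taken in an arbitrary commutative ring R; taking
-- R = ℤ[q,a,b,x] recovers the statement with q an indeterminate.
module QNotation {c ℓ : Level} (R : CommutativeRing c ℓ) where
  open CommutativeRing R hiding (zero)

  pow : Carrier → ℕ → Carrier
  pow y zero    = 1#
  pow y (suc n) = y * pow y n

  sgn : ℕ → Carrier
  sgn zero    = 1#
  sgn (suc k) = - (sgn k)

  qint : Carrier → ℕ → Carrier
  qint q zero    = 0#
  qint q (suc n) = 1# + q * qint q n

  qfact : Carrier → ℕ → Carrier
  qfact q zero    = 1#
  qfact q (suc n) = qfact q n * qint q (suc n)

  -- Gaussian binomial [n choose k], via the q-Pascal rule
  -- [n+1, k+1] = [n, k] + q^(k+1) [n, k+1]  (equals [n]!/([k]![n-k]!)).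
  qbinom : Carrier → ℕ → ℕ → Carrier
  qbinom q zero    zero    = 1#
  qbinom q zero    (suc k) = 0#
  qbinom q (suc n) zero    = 1#
  qbinom q (suc n) (suc k) = qbinom q n k + pow q (suc k) * qbinom q n (suc k)

  dag : Carrier → Carrier → Carrier → ℕ → Carrier
  dag q y x m = go m
    where
    go : ℕ → Carrier
    go zero    = 1#
    go (suc j) = go j * (y + pow q j * x)

  sumTo : ℕ → (ℕ → Carrier) → Carrier
  sumTo zero    f = f zero
  sumTo (suc n) f = sumTo n f + f (suc n)

  cseq : Carrier → Carrier → Carrier → ℕ → Carrier
  cseq q a b m = pow q m * b + qint q m * a

-- Replace the constant x by a sequence y, letting the factor at level l of the k-th summand use y l
-- (mixedFactor); the generalised identity holds for all b and y, by induction on n. Its bottom factor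
-- equals (c_{n+1} + y₀) − [k] a, because q^k c_{n+1-k} + [k] a = c_{n+1}. The part proportional to
-- c_{n+1} + y₀ is an alternating sum which the q-Pascal rule splits into two instances of size n
-- (one with b ↦ q b + a and y ↦ q y(·+1), the other with y ↦ y(·+1)) having the same value, so it
-- vanishes; by the absorption identity [k] qbinom(n+1, k) = [n+1] qbinom(n, k-1), the part
-- proportional to a is −[n+1] times an instance of size n.

module Submission where

open import Defs
open import Level using (Level)
open import Data.Nat using (ℕ; zero; suc; _∸_; _≤_; _<_; z≤n; s≤s) renaming (_+_ to _+ℕ_)
import Data.Nat.Properties as ℕ
open import Algebra.Bundles using (CommutativeRing)
open import Relation.Binary.PropositionalEquality using (cong)

module QAlternatingSums {ℓ₁ ℓ₂ : Level} (R : CommutativeRing ℓ₁ ℓ₂) where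
  open CommutativeRing R hiding (zero)
  open QNotation R
  open import Algebra.Properties.Ring ring
    using ( -‿distribˡ-*; -‿distribʳ-*; -‿+-comm; -‿involutive
          ; x[y-z]≈xy-xz; [y-z]x≈yx-zx; //-rightDividesʳ )
  open import Algebra.Properties.CommutativeSemigroup +-commutativeSemigroup
    using () renaming (interchange to +-interchange; xy∙z≈xz∙y to +-right-comm)
  open import Algebra.Properties.CommutativeSemigroup *-commutativeSemigroup
    using () renaming (x∙yz≈y∙xz to *-left-comm)
  open import Algebra.Solver.Ring.NaturalCoefficients.Default commutativeSemiring
    using (solve; _:=_; _:+_; _:*_; con)
  open import Relation.Binary.Reasoning.Setoid setoid

  x+y≈z⇒x≈z-y : ∀ {x y z} → x + y ≈ z → x ≈ z - y
  x+y≈z⇒x≈z-y {x} {y} x+y≈z = trans (sym (//-rightDividesʳ y x)) (+-congʳ x+y≈z)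

  x*-y*z≈-[x*y*z] : ∀ x y z → x * - y * z ≈ - (x * y * z)
  x*-y*z≈-[x*y*z] x y z = trans (*-congʳ (sym (-‿distribʳ-* x y))) (sym (-‿distribˡ-* (x * y) z))

  x*0-y*-z≈y*z : ∀ x y z → x * 0# - y * - z ≈ y * z
  x*0-y*-z≈y*z x y z = begin
    x * 0# - y * - z  ≈⟨ +-cong (zeroʳ x) (-‿cong (sym (-‿distribʳ-* y z))) ⟩
    0# - - (y * z)    ≈⟨ +-identityˡ _ ⟩
    - - (y * z)       ≈⟨ -‿involutive _ ⟩
    y * z             ∎

  sumTo-cong-≤ : ∀ n {f g : ℕ → Carrier} → (∀ k → k ≤ n → f k ≈ g k) →
                 sumTo n f ≈ sumTo n g
  sumTo-cong-≤ zero    f≈g = f≈g 0 z≤n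
  sumTo-cong-≤ (suc n) f≈g =
    +-cong (sumTo-cong-≤ n (λ k k≤n → f≈g k (ℕ.m≤n⇒m≤1+n k≤n))) (f≈g (suc n) ℕ.≤-refl)

  sumTo-cong : ∀ n {f g : ℕ → Carrier} → (∀ k → f k ≈ g k) → sumTo n f ≈ sumTo n g
  sumTo-cong n f≈g = sumTo-cong-≤ n (λ k _ → f≈g k)

  sumTo-distrib-+ : ∀ n (f g : ℕ → Carrier) → sumTo n (λ k → f k + g k) ≈ sumTo n f + sumTo n g
  sumTo-distrib-+ zero    f g = refl
  sumTo-distrib-+ (suc n) f g =
    trans (+-congʳ (sumTo-distrib-+ n f g)) (+-interchange _ _ _ _)

  sumTo-neg : ∀ n (f : ℕ → Carrier) → sumTo n (λ k → - f k) ≈ - sumTo n f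
  sumTo-neg zero    f = refl
  sumTo-neg (suc n) f = trans (+-congʳ (sumTo-neg n f)) (-‿+-comm _ _)

  sumTo-distrib-- : ∀ n (f g : ℕ → Carrier) → sumTo n (λ k → f k - g k) ≈ sumTo n f - sumTo n g
  sumTo-distrib-- n f g = trans (sumTo-distrib-+ n f (λ k → - g k)) (+-congˡ (sumTo-neg n g))

  *-distribˡ-sumTo : ∀ n u (f : ℕ → Carrier) → u * sumTo n f ≈ sumTo n (λ k → u * f k)
  *-distribˡ-sumTo zero    u f = refl
  *-distribˡ-sumTo (suc n) u f = trans (distribˡ u _ _) (+-congʳ (*-distribˡ-sumTo n u f))

  sumTo-unfoldˡ : ∀ n (f : ℕ → Carrier) → sumTo (suc n) f ≈ f 0 + sumTo n (λ k → f (suc k))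
  sumTo-unfoldˡ zero    f = refl
  sumTo-unfoldˡ (suc n) f = trans (+-congʳ (sumTo-unfoldˡ n f)) (+-assoc _ _ _)

  prod : ℕ → (ℕ → Carrier) → Carrier
  prod zero    g = 1#
  prod (suc n) g = g 0 * prod n (λ l → g (suc l))

  prod-cong : ∀ n {g h : ℕ → Carrier} → (∀ l → g l ≈ h l) → prod n g ≈ prod n h
  prod-cong zero    g≈h = refl
  prod-cong (suc n) g≈h = *-cong (g≈h 0) (prod-cong n (λ l → g≈h (suc l)))

  prod-unfoldʳ : ∀ n (g : ℕ → Carrier) → prod (suc n) g ≈ prod n g * g n
  prod-unfoldʳ zero    g = trans (*-identityʳ _) (sym (*-identityˡ _))
  prod-unfoldʳ (suc n) g = trans (*-congˡ (prod-unfoldʳ n (λ l → g (suc l)))) (sym (*-assoc _ _ _))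

  module _ (q : Carrier) where

    pow-+ : ∀ m n → pow q (m +ℕ n) ≈ pow q m * pow q n
    pow-+ zero    n = sym (*-identityˡ _)
    pow-+ (suc m) n = trans (*-congˡ (pow-+ m n)) (sym (*-assoc q _ _))

    -- 0 ∸ k is stuck for a variable k.
    pow-0∸ : ∀ k → pow q (0 ∸ k) ≈ 1#
    pow-0∸ zero    = refl
    pow-0∸ (suc k) = refl

    qint-+ : ∀ m n → qint q (m +ℕ n) ≈ qint q m + pow q m * qint q n
    qint-+ zero    n = sym (trans (+-identityˡ _) (*-identityˡ _))
    qint-+ (suc m) n = begin
      1# + q * qint q (m +ℕ n)                  ≈⟨ +-congˡ (*-congˡ (qint-+ m n)) ⟩
      1# + q * (qint q m + pow q m * qint q n)  ≈⟨ regroup q (qint q m) (pow q m) (qint q n) ⟩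
      1# + q * qint q m + q * pow q m * qint q n ∎
      where
      regroup = solve 4 (λ q I P J → con 1 :+ q :* (I :+ P :* J) := con 1 :+ q :* I :+ q :* P :* J) refl

    qint-1 : qint q 1 ≈ 1#
    qint-1 = trans (+-congˡ (zeroʳ q)) (+-identityʳ 1#)

    qint-suc : ∀ m → qint q (suc m) ≈ qint q m + pow q m
    qint-suc m = begin
      qint q (suc m)                 ≡⟨ cong (qint q) (ℕ.+-comm 1 m) ⟩
      qint q (m +ℕ 1)                ≈⟨ qint-+ m 1 ⟩
      qint q m + pow q m * qint q 1  ≈⟨ +-congˡ (trans (*-congˡ qint-1) (*-identityʳ _)) ⟩
      qint q m + pow q m             ∎

    qbinom[n,0]≈1 : ∀ n → qbinom q n 0 ≈ 1#
    qbinom[n,0]≈1 zero    = refl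
    qbinom[n,0]≈1 (suc n) = refl

    qbinom[n,1]≈[n] : ∀ n → qbinom q n 1 ≈ qint q n
    qbinom[n,1]≈[n] zero    = refl
    qbinom[n,1]≈[n] (suc n) =
      +-cong (qbinom[n,0]≈1 n) (*-cong (*-identityʳ q) (qbinom[n,1]≈[n] n))

    n<k⇒qbinom[n,k]≈0 : ∀ {n k} → n < k → qbinom q n k ≈ 0#
    n<k⇒qbinom[n,k]≈0 {zero}  {suc k} _         = refl
    n<k⇒qbinom[n,k]≈0 {suc n} {suc k} (s≤s n<k) = begin
      qbinom q n k + pow q (suc k) * qbinom q n (suc k)
        ≈⟨ +-cong (n<k⇒qbinom[n,k]≈0 n<k) (*-congˡ (n<k⇒qbinom[n,k]≈0 (ℕ.m≤n⇒m≤1+n n<k))) ⟩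
      0# + pow q (suc k) * 0#
        ≈⟨ trans (+-identityˡ _) (zeroʳ _) ⟩
      0# ∎

    [k+1]qbinom[n+1,k+1]≈[n+1]qbinom[n,k] : ∀ n k →
      qint q (suc k) * qbinom q (suc n) (suc k) ≈ qint q (suc n) * qbinom q n k
    [k+1]qbinom[n+1,k+1]≈[n+1]qbinom[n,k] n zero = begin
      qint q 1 * qbinom q (suc n) 1  ≈⟨ *-cong qint-1 (qbinom[n,1]≈[n] (suc n)) ⟩
      1# * qint q (suc n)            ≈⟨ *-identityˡ _ ⟩
      qint q (suc n)                 ≈⟨ *-identityʳ _ ⟨
      qint q (suc n) * 1#            ≈⟨ *-congˡ (qbinom[n,0]≈1 n) ⟨
      qint q (suc n) * qbinom q n 0  ∎
    [k+1]qbinom[n+1,k+1]≈[n+1]qbinom[n,k] zero (suc k) = begin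
      qint q (suc (suc k)) * qbinom q 1 (suc (suc k))
        ≈⟨ *-congˡ (n<k⇒qbinom[n,k]≈0 {1} {suc (suc k)} (s≤s (s≤s z≤n))) ⟩
      qint q (suc (suc k)) * 0#  ≈⟨ zeroʳ _ ⟩
      0#                         ≈⟨ zeroʳ _ ⟨
      qint q 1 * 0#              ∎
    [k+1]qbinom[n+1,k+1]≈[n+1]qbinom[n,k] (suc n) (suc k) = begin
      (1# + q * K) * (B₁ + q * P * B₂)
        ≈⟨ regroup q K B₁ P B₂ ⟩
      B₁ + q * (K * B₁) + q * P * ((1# + q * K) * B₂)
        ≈⟨ +-cong (+-congˡ (*-congˡ ([k+1]qbinom[n+1,k+1]≈[n+1]qbinom[n,k] n k)))
                  (*-congˡ ([k+1]qbinom[n+1,k+1]≈[n+1]qbinom[n,k] n (suc k))) ⟩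
      (B + P * B′) + q * (N * B) + q * P * (N * B′)
        ≈⟨ collect q N B P B′ ⟩
      (1# + q * N) * (B + P * B′) ∎
      where
      K  = qint q (suc k)
      N  = qint q (suc n)
      P  = pow q (suc k)
      B  = qbinom q n k
      B′ = qbinom q n (suc k)
      B₁ = qbinom q (suc n) (suc k)
      B₂ = qbinom q (suc n) (suc (suc k))
      regroup = solve 5 (λ q K B₁ P B₂ →
        (con 1 :+ q :* K) :* (B₁ :+ q :* P :* B₂)
          := B₁ :+ q :* (K :* B₁) :+ q :* P :* ((con 1 :+ q :* K) :* B₂)) refl
      collect = solve 5 (λ q N B P B′ →
        (B :+ P :* B′) :+ q :* (N :* B) :+ q :* P :* (N :* B′)
          := (con 1 :+ q :* N) :* (B :+ P :* B′)) refl

    qAltSum : ℕ → (ℕ → Carrier) → Carrier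
    qAltSum n f = sumTo n (λ k → qbinom q n k * sgn k * f k)

    qAltSum-cong-≤ : ∀ n {f g : ℕ → Carrier} → (∀ k → k ≤ n → f k ≈ g k) →
                     qAltSum n f ≈ qAltSum n g
    qAltSum-cong-≤ n f≈g = sumTo-cong-≤ n (λ k k≤n → *-congˡ (f≈g k k≤n))

    qAltSum-distrib-- : ∀ n (f g : ℕ → Carrier) →
                        qAltSum n (λ k → f k - g k) ≈ qAltSum n f - qAltSum n g
    qAltSum-distrib-- n f g =
      trans (sumTo-cong n (λ k → x[y-z]≈xy-xz _ (f k) (g k))) (sumTo-distrib-- n _ _)

    *-distribˡ-qAltSum : ∀ n u (f : ℕ → Carrier) → u * qAltSum n f ≈ qAltSum n (λ k → u * f k)
    *-distribˡ-qAltSum n u f =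
      trans (*-distribˡ-sumTo n u _) (sumTo-cong n (λ k → *-left-comm u _ (f k)))

    -- The q-Pascal rule, then a reindexing of the terms involving qbinom q n (suc k).
    qAltSum-suc : ∀ n (f : ℕ → Carrier) →
                  qAltSum (suc n) f ≈ qAltSum n (λ k → pow q k * f k - f (suc k))
    qAltSum-suc n f = begin
      qAltSum (suc n) f
        ≈⟨ trans (sumTo-unfoldˡ n _) (+-cong bottom (sumTo-cong n pascal)) ⟩
      φ 0 + sumTo n (λ k → φ (suc k) - ψ k)
        ≈⟨ +-congˡ (sumTo-distrib-- n _ ψ) ⟩
      φ 0 + (sumTo n (λ k → φ (suc k)) - sumTo n ψ)
        ≈⟨ +-assoc _ _ _ ⟨
      φ 0 + sumTo n (λ k → φ (suc k)) - sumTo n ψ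
        ≈⟨ +-congʳ (trans (sym (sumTo-unfoldˡ n φ)) (+-congˡ top)) ⟩
      sumTo n φ + 0# - sumTo n ψ
        ≈⟨ +-congʳ (+-identityʳ _) ⟩
      sumTo n φ - sumTo n ψ
        ≈⟨ sumTo-distrib-- n φ ψ ⟨
      sumTo n (λ k → φ k - ψ k)
        ≈⟨ sumTo-cong n (λ k → x[y-z]≈xy-xz _ _ _) ⟨
      qAltSum n (λ k → pow q k * f k - f (suc k)) ∎
      where
      φ ψ : ℕ → Carrier
      φ k = qbinom q n k * sgn k * (pow q k * f k)
      ψ k = qbinom q n k * sgn k * f (suc k)
      bottom : qbinom q (suc n) 0 * 1# * f 0 ≈ φ 0
      bottom = *-cong (*-congʳ (trans (qbinom[n,0]≈1 (suc n)) (sym (qbinom[n,0]≈1 n))))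
                      (sym (*-identityˡ _))
      top : φ (suc n) ≈ 0#
      top = trans (*-congʳ (*-congʳ (n<k⇒qbinom[n,k]≈0 {n} ℕ.≤-refl)))
                  (trans (*-congʳ (zeroˡ _)) (zeroˡ _))
      pascal : ∀ k → qbinom q (suc n) (suc k) * - sgn k * f (suc k) ≈ φ (suc k) - ψ k
      pascal k = trans (split (qbinom q n k) (pow q (suc k)) (qbinom q n (suc k)) (- sgn k) (f (suc k)))
                       (+-congˡ (x*-y*z≈-[x*y*z] _ _ _))
        where
        split = solve 5 (λ B P B′ s F →
          (B :+ P :* B′) :* s :* F := B′ :* s :* (P :* F) :+ B :* s :* F) refl

    qAltSum-qint : ∀ n (f : ℕ → Carrier) →
      qAltSum (suc n) (λ k → qint q k * f k) ≈ - (qint q (suc n) * qAltSum n (λ k → f (suc k)))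
    qAltSum-qint n f = begin
      qAltSum (suc n) (λ k → qint q k * f k)
        ≈⟨ trans (sumTo-unfoldˡ n _) (+-cong bottom (sumTo-cong n absorb)) ⟩
      0# + sumTo n (λ k → - (N * ψ k))
        ≈⟨ trans (+-identityˡ _) (sumTo-neg n _) ⟩
      - sumTo n (λ k → N * ψ k)
        ≈⟨ -‿cong (*-distribˡ-sumTo n N ψ) ⟨
      - (N * qAltSum n (λ k → f (suc k))) ∎
      where
      N = qint q (suc n)
      ψ : ℕ → Carrier
      ψ k = qbinom q n k * sgn k * f (suc k)
      bottom : qbinom q (suc n) 0 * 1# * (qint q 0 * f 0) ≈ 0#
      bottom = trans (*-congˡ (zeroˡ _)) (zeroʳ _)
      absorb : ∀ k → qbinom q (suc n) (suc k) * - sgn k * (qint q (suc k) * f (suc k)) ≈ - (N * ψ k)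
      absorb k = begin
        B′ * - s * (K * F)    ≈⟨ x*-y*z≈-[x*y*z] B′ s (K * F) ⟩
        - (B′ * s * (K * F))  ≈⟨ -‿cong (pull B′ s K F) ⟩
        - (K * B′ * (s * F))  ≈⟨ -‿cong (*-congʳ ([k+1]qbinom[n+1,k+1]≈[n+1]qbinom[n,k] n k)) ⟩
        - (N * B * (s * F))   ≈⟨ -‿cong (push N B s F) ⟩
        - (N * (B * s * F))   ∎
        where
        K = qint q (suc k)
        B = qbinom q n k
        B′ = qbinom q (suc n) (suc k)
        s = sgn k
        F = f (suc k)
        pull = solve 4 (λ B′ s K F → B′ :* s :* (K :* F) := K :* B′ :* (s :* F)) refl
        push = solve 4 (λ N B s F → N :* B :* (s :* F) := N :* (B :* s :* F)) refl

    -- At level l the factor is q^(k-l) c + y l below k and c + q^(l-k) y l from k on; for constant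
    -- y = x the levels below k give (x † q c)^k and the others (c † x)^(n-k).
    mixedFactor : ℕ → ℕ → Carrier → Carrier → Carrier
    mixedFactor k l c y = pow q (k ∸ l) * c + pow q (l ∸ k) * y

    mixedProduct : ℕ → ℕ → Carrier → (ℕ → Carrier) → Carrier
    mixedProduct n k c y = prod n (λ l → mixedFactor k l c (y l))

    mixedProduct-raise : ∀ n k c (y : ℕ → Carrier) → k ≤ n →
      pow q k * prod n (λ l → mixedFactor k (suc l) c (y l)) ≈ mixedProduct n k c (λ l → q * y l)
    mixedProduct-raise n zero c y _ = trans (*-identityˡ _) (prod-cong n raise)
      where
      raise : ∀ l → mixedFactor 0 (suc l) c (y l) ≈ mixedFactor 0 l c (q * y l)
      raise l = +-cong (*-congʳ (sym (pow-0∸ l))) (trans (*-assoc q _ _) (*-left-comm q _ _))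
    mixedProduct-raise (suc n) (suc k) c y (s≤s k≤n) = begin
      q * pow q k * ((pow q k * c + pow q (0 ∸ k) * y 0) * X)
        ≈⟨ *-congˡ (*-congʳ (+-congˡ (*-congʳ (pow-0∸ k)))) ⟩
      q * pow q k * ((pow q k * c + 1# * y 0) * X)
        ≈⟨ regroup q (pow q k) c (y 0) X ⟩
      (q * pow q k * c + 1# * (q * y 0)) * (pow q k * X)
        ≈⟨ *-congˡ (mixedProduct-raise n k c (λ l → y (suc l)) k≤n) ⟩
      (q * pow q k * c + 1# * (q * y 0)) * mixedProduct n k c (λ l → q * y (suc l)) ∎
      where
      X = prod n (λ l → mixedFactor k (suc l) c (y (suc l)))
      regroup = solve 5 (λ q P c y X →
        q :* P :* ((P :* c :+ con 1 :* y) :* X) := (q :* P :* c :+ con 1 :* (q :* y)) :* (P :* X)) refl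

    mixedProduct-const₀ : ∀ m c x → mixedProduct m 0 c (λ _ → x) ≈ dag q c x m
    mixedProduct-const₀ zero    c x = refl
    mixedProduct-const₀ (suc m) c x = trans (prod-unfoldʳ m _)
      (*-cong (mixedProduct-const₀ m c x) (+-congʳ (trans (*-congʳ (pow-0∸ m)) (*-identityˡ c))))

    mixedProduct-const : ∀ k m c x →
                         mixedProduct (k +ℕ m) k c (λ _ → x) ≈ dag q c x m * dag q x (q * c) k
    mixedProduct-const zero    m c x = trans (mixedProduct-const₀ m c x) (sym (*-identityʳ _))
    mixedProduct-const (suc k) m c x = begin
      (q * pow q k * c + 1# * x) * mixedProduct (k +ℕ m) k c (λ _ → x)
        ≈⟨ *-congˡ (mixedProduct-const k m c x) ⟩
      (q * pow q k * c + 1# * x) * (dag q c x m * dag q x (q * c) k)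
        ≈⟨ regroup q (pow q k) c x (dag q c x m) (dag q x (q * c) k) ⟩
      dag q c x m * (dag q x (q * c) k * (x + pow q k * (q * c))) ∎
      where
      regroup = solve 6 (λ q P c x A D →
        (q :* P :* c :+ con 1 :* x) :* (A :* D) := A :* (D :* (x :+ P :* (q :* c)))) refl

  module _ (q a : Carrier) where

    -- cseq q a b m is the m-th iterate of b under z ↦ q z + a.
    cseq-+ : ∀ b k m → pow q k * cseq q a b m + qint q k * a ≈ cseq q a b (k +ℕ m)
    cseq-+ b k m = begin
      pow q k * (pow q m * b + qint q m * a) + qint q k * a
        ≈⟨ regroup (pow q k) (pow q m) b (qint q m) (qint q k) a ⟩
      pow q k * pow q m * b + (qint q k + pow q k * qint q m) * a
        ≈⟨ +-cong (*-congʳ (pow-+ q k m)) (*-congʳ (qint-+ q k m)) ⟨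
      pow q (k +ℕ m) * b + qint q (k +ℕ m) * a ∎
      where
      regroup = solve 6 (λ P P′ b I′ I a →
        P :* (P′ :* b :+ I′ :* a) :+ I :* a := P :* P′ :* b :+ (I :+ P :* I′) :* a) refl

    cseq-suc : ∀ b m → cseq q a b (suc m) ≈ cseq q a (q * b + a) m
    cseq-suc b m = begin
      q * pow q m * b + qint q (suc m) * a        ≈⟨ +-congˡ (*-congʳ (qint-suc q m)) ⟩
      q * pow q m * b + (qint q m + pow q m) * a  ≈⟨ regroup q (pow q m) b (qint q m) a ⟩
      pow q m * (q * b + a) + qint q m * a        ∎
      where
      regroup = solve 5 (λ q P b I a → q :* P :* b :+ (I :+ P) :* a := P :* (q :* b :+ a) :+ I :* a) refl

    mixedTerm : ℕ → Carrier → (ℕ → Carrier) → ℕ → Carrier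
    mixedTerm n b y k = mixedProduct q n k (cseq q a b (n ∸ k)) y

    mixedTerm-const : ∀ b x {n k} → k ≤ n → let c = cseq q a b (n ∸ k) in
      mixedTerm n b (λ _ → x) k ≈ dag q c x (n ∸ k) * dag q x (q * c) k
    mixedTerm-const b x {n} {k} k≤n = begin
      mixedProduct q n k c (λ _ → x)
        ≡⟨ cong (λ m → mixedProduct q m k c (λ _ → x)) (ℕ.m+[n∸m]≡n k≤n) ⟨
      mixedProduct q (k +ℕ (n ∸ k)) k c (λ _ → x)
        ≈⟨ mixedProduct-const q k (n ∸ k) c x ⟩
      dag q c x (n ∸ k) * dag q x (q * c) k ∎
      where
      c = cseq q a b (n ∸ k)

    -- mixedTerm (suc n) b y k is the bottom factor mixedFactor q k 0 … (y 0) times this.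
    mixedTail : ℕ → Carrier → (ℕ → Carrier) → ℕ → Carrier
    mixedTail n b y k = prod n (λ l → mixedFactor q k (suc l) (cseq q a b (suc n ∸ k)) (y (suc l)))

    mixedFactor-bottom : ∀ b y₀ {n k} → k ≤ n →
      mixedFactor q k 0 (cseq q a b (n ∸ k)) y₀ ≈ cseq q a b n + y₀ - qint q k * a
    mixedFactor-bottom b y₀ {n} {k} k≤n = x+y≈z⇒x≈z-y (begin
      pow q k * c + pow q (0 ∸ k) * y₀ + qint q k * a
        ≈⟨ +-congʳ (+-congˡ (trans (*-congʳ (pow-0∸ q k)) (*-identityˡ y₀))) ⟩
      pow q k * c + y₀ + qint q k * a
        ≈⟨ +-right-comm _ _ _ ⟩
      pow q k * c + qint q k * a + y₀
        ≈⟨ +-congʳ (cseq-+ b k (n ∸ k)) ⟩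
      cseq q a b (k +ℕ (n ∸ k)) + y₀
        ≡⟨ cong (λ m → cseq q a b m + y₀) (ℕ.m+[n∸m]≡n k≤n) ⟩
      cseq q a b n + y₀ ∎)
      where
      c = cseq q a b (n ∸ k)

    mixedTerm-suc : ∀ n b y {k} → k ≤ suc n →
      let C = cseq q a b (suc n) + y 0; T = mixedTail n b y k in
      mixedTerm (suc n) b y k ≈ C * T - a * (qint q k * T)
    mixedTerm-suc n b y {k} k≤1+n = begin
      mixedFactor q k 0 (cseq q a b (suc n ∸ k)) (y 0) * T
        ≈⟨ *-congʳ (mixedFactor-bottom b (y 0) k≤1+n) ⟩
      (C - qint q k * a) * T
        ≈⟨ [y-z]x≈yx-zx T C _ ⟩
      C * T - qint q k * a * T
        ≈⟨ +-congˡ (-‿cong (trans (*-assoc _ _ _) (*-left-comm _ a _))) ⟩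
      C * T - a * (qint q k * T) ∎
      where
      C = cseq q a b (suc n) + y 0
      T = mixedTail n b y k

    mixedTail-raise : ∀ n b y {k} → k ≤ n →
      pow q k * mixedTail n b y k ≈ mixedTerm n (q * b + a) (λ l → q * y (suc l)) k
    mixedTail-raise n b y {k} k≤n = trans (mixedProduct-raise q n k _ (λ l → y (suc l)) k≤n)
                                          (prod-cong n (λ l → +-congʳ (*-congˡ shift)))
      where
      shift : cseq q a b (suc n ∸ k) ≈ cseq q a (q * b + a) (n ∸ k)
      shift = trans (reflexive (cong (cseq q a b) (ℕ.+-∸-assoc 1 k≤n))) (cseq-suc b (n ∸ k))

    qAltSum-mixedTerm : ∀ n b y → qAltSum q n (mixedTerm n b y) ≈ qfact q n * pow a n
    qAltSum-mixedTerm zero    b y = *-identityʳ _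
    qAltSum-mixedTerm (suc n) b y = begin
      qAltSum q (suc n) (mixedTerm (suc n) b y)
        ≈⟨ qAltSum-cong-≤ q (suc n) (λ k → mixedTerm-suc n b y) ⟩
      qAltSum q (suc n) (λ k → C * T k - a * (qint q k * T k))
        ≈⟨ qAltSum-distrib-- q (suc n) _ _ ⟩
      qAltSum q (suc n) (λ k → C * T k) - qAltSum q (suc n) (λ k → a * (qint q k * T k))
        ≈⟨ +-cong (*-distribˡ-qAltSum q (suc n) C T) (-‿cong (*-distribˡ-qAltSum q (suc n) a _)) ⟨
      C * qAltSum q (suc n) T - a * qAltSum q (suc n) (λ k → qint q k * T k)
        ≈⟨ +-cong (*-congˡ tail-vanishes) (-‿cong (*-congˡ weighted-tail)) ⟩
      C * 0# - a * - (qint q (suc n) * (qfact q n * pow a n))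
        ≈⟨ x*0-y*-z≈y*z C a _ ⟩
      a * (qint q (suc n) * (qfact q n * pow a n))
        ≈⟨ regroup a (qint q (suc n)) (qfact q n) (pow a n) ⟩
      qfact q (suc n) * pow a (suc n) ∎
      where
      C = cseq q a b (suc n) + y 0
      T = mixedTail n b y
      y′ y″ : ℕ → Carrier
      y′ l = y (suc l)
      y″ l = q * y (suc l)
      regroup = solve 4 (λ a N F A → a :* (N :* (F :* A)) := F :* N :* (a :* A)) refl

      -- T (suc k) is literally mixedTerm n b y′ k.
      tail-vanishes : qAltSum q (suc n) T ≈ 0#
      tail-vanishes = begin
        qAltSum q (suc n) T
          ≈⟨ qAltSum-suc q n T ⟩
        qAltSum q n (λ k → pow q k * T k - T (suc k))
          ≈⟨ qAltSum-cong-≤ q n (λ k k≤n → +-congʳ (mixedTail-raise n b y k≤n)) ⟩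
        qAltSum q n (λ k → mixedTerm n (q * b + a) y″ k - mixedTerm n b y′ k)
          ≈⟨ qAltSum-distrib-- q n _ _ ⟩
        qAltSum q n (mixedTerm n (q * b + a) y″) - qAltSum q n (mixedTerm n b y′)
          ≈⟨ +-cong (qAltSum-mixedTerm n (q * b + a) y″) (-‿cong (qAltSum-mixedTerm n b y′)) ⟩
        qfact q n * pow a n - qfact q n * pow a n
          ≈⟨ -‿inverseʳ _ ⟩
        0# ∎

      weighted-tail : qAltSum q (suc n) (λ k → qint q k * T k)
                      ≈ - (qint q (suc n) * (qfact q n * pow a n))
      weighted-tail = trans (qAltSum-qint q n T) (-‿cong (*-congˡ (qAltSum-mixedTerm n b y′)))

mainTheorem13 : ∀ {c ℓ : Level} (R : CommutativeRing c ℓ) →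
    let open CommutativeRing R
        open QNotation R
    in
    ∀ (q a b x : Carrier) (n : ℕ) →
      sumTo n (λ k → qbinom q n k * sgn k
                       * dag q (cseq q a b (n ∸ k)) x (n ∸ k)
                       * dag q x (q * cseq q a b (n ∸ k)) k)
        ≈ qfact q n * pow a n
mainTheorem13 R q a b x n = begin
  sumTo n (λ k → qbinom q n k * sgn k * dag q (c k) x (n ∸ k) * dag q x (q * c k) k)
    ≈⟨ sumTo-cong-≤ n (λ k k≤n → trans (*-assoc _ _ _)
                                        (*-congˡ (sym (mixedTerm-const q a b x k≤n)))) ⟩
  qAltSum q n (mixedTerm q a n b (λ _ → x))
    ≈⟨ qAltSum-mixedTerm q a n b (λ _ → x) ⟩
  qfact q n * pow a n ∎
  where
  open CommutativeRing R
  open QNotation R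
  open QAlternatingSums R
  open import Relation.Binary.Reasoning.Setoid setoid
  c : ℕ → Carrier
  c k = cseq q a b (n ∸ k)
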